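{- Let $\Sigma$ be a many-typed signature and let $\sigma,\tau$ be simple types over its atomic types. Then the glued object $[\![\sigma\times\tau]\!]=(P_{\sigma\times\tau},\ \sigma\times\tau,\ \downarrow^{\mathrm{nf}}_{\sigma\times\tau}\circ\mathrm{reify}_{\sigma\times\tau})$ is a cartesian product of $[\![\sigma]\!]$ and $[\![\tau]\!]$ in the gluing category $\mathrm{Gl}(\Sigma)$.
   Context: A many-typed signature $\Sigma=(S,O)$ consists of a set $S$ of atomic types and a set of operation symbols $\vartheta$, each with an arity $O(\vartheta)=(\Delta,\tau)$ where $\Delta$ is a finite list of types and $\tau$ a type. The simple types $\mathrm{Ty}(S)$ are generated from $S$ by binary $\times$ and $\to$; a context is a finite list of types. Syntax (classifying category). Terms $\Gamma\vdash t:\tau$ and substitutions $\Gamma\vdash\delta:\Delta$ are generated by: the last variable $\Gamma,\tau\vdash \mathrm{v}:\tau$; an operation $\Delta\vdash\vartheta:\tau$ whenever $O(\vartheta)=(\Delta,\tau)$; explicit substitution $t[\delta]$; $\lambda$-abstraction, application, pairing, the two projections $t.1,t.2$; and the substitutions $\mathrm{id}_\Gamma$, the weakening $\mathrm{p}:(\Gamma,\tau)\to\Gamma$, extension $(\delta,t):\Gamma\to(\Delta,\tau)$ and composition. These are quotiented by the congruence generated by $\beta$- and $\eta$-laws for functions and for pairs, the category laws for substitutions, $\mathrm{p}\circ(\delta,t)=\delta$, $(\xi,t)\circ\delta=(\xi\circ\delta,t[\delta])$, $\mathrm{v}[(\delta,t)]=t$, $\mathrm{v}[\mathrm{id}]=\mathrm{v}$,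 and the laws commuting substitution with every term former (under $\lambda$ using the lifted substitution $(\mathrm{p}\circ\delta,\mathrm{v})$). The classifying category $\mathrm{Cl}(\Sigma)$ has contexts as objects and equivalence classes of substitutions as morphisms; a type $\tau$ is identified with the one-element context, so terms $\Gamma\vdash t:\tau$ are morphisms $\Gamma\to\tau$. The category of renamings $\mathrm{Ren}(\Sigma)$ has the same objects, a morphism $\Gamma\to\Delta$ being an assignment to each entry of $\Delta$ of a variable of $\Gamma$ of the same type; $i:\mathrm{Ren}(\Sigma)\to\mathrm{Cl}(\Sigma)$ is the evident inclusion. Write $\mathrm{Psh}(\mathrm{Ren}(\Sigma))$ for presheaves of sets on $\mathrm{Ren}(\Sigma)$ and $\mathrm{TM}:\mathrm{Cl}(\Sigma)\to\mathrm{Psh}(\mathrm{Ren}(\Sigma))$ for $\mathrm{TM}(\Delta)=\mathrm{Hom}_{\mathrm{Cl}(\Sigma)}(i(-),\Delta)$. Neutral and normal forms (unquotiented syntax, closed under renaming). Neutral terms: variables $\mathrm{v}[\mathrm{p}^k]$; $\vartheta[\delta]$ with $\delta$ a normal substitution into the arity context of $\vartheta$; $t(s)$ with $t$ neutral and $s$ normal; $t.1$, $t.2$ with $t$ neutral. Normal terms: neutral terms of atomic type; $\lambda^\sigma.t$ with $t$ normal; pairs of normal terms. Neutral (resp. normal) substitutions are tuples of neutral (resp. normal) terms. $\mathrm{NE}_\tau(\Gamma)$, $\mathrm{NF}_\tau(\Gamma)$ (and $\mathrm{NE}_\Delta,\mathrm{NF}_\Delta$ for contexts) are the presheaves of these;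 $\downarrow^{\mathrm{ne}}:\mathrm{NE}_\tau\to\mathrm{TM}(\tau)$ and $\downarrow^{\mathrm{nf}}:\mathrm{NF}_\tau\to\mathrm{TM}(\tau)$ send a term to its equivalence class. Logical predicates. By induction on types one defines presheaves $P_\tau$ and natural maps $\mathrm{reflect}_\tau:\mathrm{NE}_\tau\to P_\tau$, $\mathrm{reify}_\tau:P_\tau\to\mathrm{NF}_\tau$: for atomic $\tau$, $P_\tau=\mathrm{NF}_\tau$, reflect is the inclusion of neutrals into normals and reify is the identity; $P_{\sigma\times\tau}=P_\sigma\times P_\tau$, $\mathrm{reflect}(t)=(\mathrm{reflect}(t.1),\mathrm{reflect}(t.2))$, $\mathrm{reify}(a,b)=(\mathrm{reify}\,a,\mathrm{reify}\,b)$; $P_{\sigma\to\tau}$ is the pullback of $\phi:P_\tau^{P_\sigma}\to\mathrm{TM}(\tau)^{P_\sigma}$, $\phi(F)=\lambda v.\downarrow^{\mathrm{nf}}\mathrm{reify}_\tau(F v)$, along $\psi:\mathrm{TM}(\sigma\to\tau)\to\mathrm{TM}(\tau)^{P_\sigma}$, $\psi(t)=\lambda v.\,t(\downarrow^{\mathrm{nf}}\mathrm{reify}_\sigma v)$ (computed in the internal language of the presheaf topos), so its elements are pairs $(t,F)$; $\mathrm{reflect}_{\sigma\to\tau}(t)=(\downarrow^{\mathrm{ne}}t,\ \lambda v.\,\mathrm{reflect}_\tau(t(\mathrm{reify}_\sigma v)))$ and $\mathrm{reify}_{\sigma\to\tau}(t,F)=\lambda^\sigma.\,\mathrm{reify}_\tau(F(\mathrm{reflect}_\sigma(x)))$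 with $x$ the fresh bound variable (after weakening). For contexts, $P_{[\,]}=1$, $P_{\Gamma,\tau}=P_\Gamma\times P_\tau$, with reflect/reify componentwise. Gluing category. $\mathrm{Gl}(\Sigma)$ is the comma category $\mathrm{id}_{\mathrm{Psh}(\mathrm{Ren}(\Sigma))}\downarrow\mathrm{TM}$: objects are triples $(\mathcal D,\Delta,q)$ with $\mathcal D$ a presheaf, $\Delta$ a context and $q:\mathcal D\to\mathrm{TM}(\Delta)$; morphisms $(\mathcal G,\Gamma,q_\Gamma)\to(\mathcal D,\Delta,q_\Delta)$ are pairs $(d:\mathcal G\to\mathcal D,\ \delta:\Gamma\to\Delta \text{ in } \mathrm{Cl}(\Sigma))$ with $q_\Delta\circ d=\mathrm{TM}(\delta)\circ q_\Gamma$. For a type $\tau$, $[\![\tau]\!]=(P_\tau,\tau,\downarrow^{\mathrm{nf}}_\tau\circ\mathrm{reify}_\tau)$. -}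

module Defs where

open import Level using (Level; _⊔_) renaming (suc to lsuc; zero to lzero)
open import Data.List using (List; []; _∷_)
open import Data.Product using (Σ; _,_; proj₁; proj₂; _×_)
open import Relation.Binary.PropositionalEquality as ≡ using (_≡_; refl; cong; cong₂)
open import Relation.Binary using (IsEquivalence; Setoid)

data Ty (S : Set) : Set where
  base : S → Ty S
  _⊗_  : Ty S → Ty S → Ty S
  _⇒_  : Ty S → Ty S → Ty S

infixr 6 _⊗_
infixr 5 _⇒_

record Signature : Set₁ where
  field
    Sort : Set
    Op   : Set
    dom  : Op → List (Ty Sort)
    cod  : Op → Ty Sort

record Category (o h e : Level) : Set (lsuc (o ⊔ h ⊔ e)) where
  infix  4 _≈_
  infixr 9 _∘_
  field
    Obj       : Set o
    Hom       : Obj → Obj → Set h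
    _≈_       : ∀ {A B} → Hom A B → Hom A B → Set e
    ≈-equiv   : ∀ {A B} → IsEquivalence (_≈_ {A} {B})
    id        : ∀ {A} → Hom A A
    _∘_       : ∀ {A B C} → Hom B C → Hom A B → Hom A C
    identityˡ : ∀ {A B} {f : Hom A B} → id ∘ f ≈ f
    identityʳ : ∀ {A B} {f : Hom A B} → f ∘ id ≈ f
    assoc     : ∀ {A B C D} {f : Hom A B} {g : Hom B C} {h : Hom C D} →
                (h ∘ g) ∘ f ≈ h ∘ (g ∘ f)
    ∘-resp-≈  : ∀ {A B C} {f f' : Hom B C} {g g' : Hom A B} →
                f ≈ f' → g ≈ g' → f ∘ g ≈ f' ∘ g'

record IsProduct {o h e} (C : Category o h e) (A B P : Category.Obj C) : Set (o ⊔ h ⊔ e) where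
  open Category C
  field
    π₁       : Hom P A
    π₂       : Hom P B
    ⟨_,_⟩    : ∀ {X} → Hom X A → Hom X B → Hom X P
    project₁ : ∀ {X} {f : Hom X A} {g : Hom X B} → π₁ ∘ ⟨ f , g ⟩ ≈ f
    project₂ : ∀ {X} {f : Hom X A} {g : Hom X B} → π₂ ∘ ⟨ f , g ⟩ ≈ g
    unique   : ∀ {X} {h : Hom X P} {f : Hom X A} {g : Hom X B} →
               π₁ ∘ h ≈ f → π₂ ∘ h ≈ g → ⟨ f , g ⟩ ≈ h

module Gluing (𝔖 : Signature) where
  open Signature 𝔖

  Type : Set
  Type = Ty Sort

  -- contexts; the context  Γ , τ  is written  τ ∷ Γ
  Ctx : Set
  Ctx = List Type

  private
    variable
      σ τ ρτ : Type
      Γ Δ Ξ Θ : Ctx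

  infixl 8 _[_]
  infixl 6 _,ₛ_
  infixr 9 _∘ₛ_

  data Tm : Ctx → Type → Set
  data Sub : Ctx → Ctx → Set

  data Tm where
    v    : Tm (τ ∷ Γ) τ
    op   : (ϑ : Op) → Tm (dom ϑ) (cod ϑ)
    _[_] : Tm Δ τ → Sub Γ Δ → Tm Γ τ
    lam  : Tm (σ ∷ Γ) τ → Tm Γ (σ ⇒ τ)
    app  : Tm Γ (σ ⇒ τ) → Tm Γ σ → Tm Γ τ
    pair : Tm Γ σ → Tm Γ τ → Tm Γ (σ ⊗ τ)
    fst  : Tm Γ (σ ⊗ τ) → Tm Γ σ
    snd  : Tm Γ (σ ⊗ τ) → Tm Γ τ

  data Sub where
    idₛ   : Sub Γ Γ
    p     : Sub (τ ∷ Γ) Γ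
    _,ₛ_  : Sub Γ Δ → Tm Γ τ → Sub Γ (τ ∷ Δ)
    _∘ₛ_  : Sub Δ Ξ → Sub Γ Δ → Sub Γ Ξ

  infix 4 _≈t_ _≈s_
  data _≈t_ : Tm Γ τ → Tm Γ τ → Set
  data _≈s_ : Sub Γ Δ → Sub Γ Δ → Set

  data _≈t_ where
    reflt  : {t : Tm Γ τ} → t ≈t t
    symt   : {t u : Tm Γ τ} → t ≈t u → u ≈t t
    transt : {t u w : Tm Γ τ} → t ≈t u → u ≈t w → t ≈t w
    []-cong   : {t t' : Tm Δ τ} {δ δ' : Sub Γ Δ} → t ≈t t' → δ ≈s δ' → t [ δ ] ≈t t' [ δ' ]
    lam-cong  : {t t' : Tm (σ ∷ Γ) τ} → t ≈t t' → lam t ≈t lam t'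
    app-cong  : {t t' : Tm Γ (σ ⇒ τ)} {s s' : Tm Γ σ} → t ≈t t' → s ≈t s' → app t s ≈t app t' s'
    pair-cong : {t t' : Tm Γ σ} {s s' : Tm Γ τ} → t ≈t t' → s ≈t s' → pair t s ≈t pair t' s'
    fst-cong  : {t t' : Tm Γ (σ ⊗ τ)} → t ≈t t' → fst t ≈t fst t'
    snd-cong  : {t t' : Tm Γ (σ ⊗ τ)} → t ≈t t' → snd t ≈t snd t'
    ⇒β : (t : Tm (σ ∷ Γ) τ) (s : Tm Γ σ) → app (lam t) s ≈t t [ idₛ ,ₛ s ]
    ⇒η : (t : Tm Γ (σ ⇒ τ)) → t ≈t lam (app (t [ p ]) v)
    ⊗β₁ : (t : Tm Γ σ) (s : Tm Γ τ) → fst (pair t s) ≈t t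
    ⊗β₂ : (t : Tm Γ σ) (s : Tm Γ τ) → snd (pair t s) ≈t s
    ⊗η  : (t : Tm Γ (σ ⊗ τ)) → t ≈t pair (fst t) (snd t)
    v[,]  : (δ : Sub Γ Δ) (t : Tm Γ τ) → v [ δ ,ₛ t ] ≈t t
    v[id] : v [ idₛ ] ≈t v {τ} {Γ}
    [id]   : (t : Tm Γ τ) → t [ idₛ ] ≈t t
    [][]   : (t : Tm Ξ τ) (δ : Sub Δ Ξ) (ξ : Sub Γ Δ) → t [ δ ] [ ξ ] ≈t t [ δ ∘ₛ ξ ]
    lam[]  : (t : Tm (σ ∷ Δ) τ) (δ : Sub Γ Δ) → lam t [ δ ] ≈t lam (t [ (δ ∘ₛ p) ,ₛ v ])
    app[]  : (t : Tm Δ (σ ⇒ τ)) (s : Tm Δ σ) (δ : Sub Γ Δ) → app t s [ δ ] ≈t app (t [ δ ]) (s [ δ ])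
    pair[] : (t : Tm Δ σ) (s : Tm Δ τ) (δ : Sub Γ Δ) → pair t s [ δ ] ≈t pair (t [ δ ]) (s [ δ ])
    fst[]  : (t : Tm Δ (σ ⊗ τ)) (δ : Sub Γ Δ) → fst t [ δ ] ≈t fst (t [ δ ])
    snd[]  : (t : Tm Δ (σ ⊗ τ)) (δ : Sub Γ Δ) → snd t [ δ ] ≈t snd (t [ δ ])

  data _≈s_ where
    refls  : {δ : Sub Γ Δ} → δ ≈s δ
    syms   : {δ ξ : Sub Γ Δ} → δ ≈s ξ → ξ ≈s δ
    transs : {δ ξ ζ : Sub Γ Δ} → δ ≈s ξ → ξ ≈s ζ → δ ≈s ζ
    ,-cong : {δ δ' : Sub Γ Δ} {t t' : Tm Γ τ} → δ ≈s δ' → t ≈t t' → (δ ,ₛ t) ≈s (δ' ,ₛ t')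
    ∘-cong : {δ δ' : Sub Δ Ξ} {ξ ξ' : Sub Γ Δ} → δ ≈s δ' → ξ ≈s ξ' → δ ∘ₛ ξ ≈s δ' ∘ₛ ξ'
    idl   : (δ : Sub Γ Δ) → idₛ ∘ₛ δ ≈s δ
    idr   : (δ : Sub Γ Δ) → δ ∘ₛ idₛ ≈s δ
    assoc : (δ : Sub Ξ Θ) (ξ : Sub Δ Ξ) (ζ : Sub Γ Δ) → (δ ∘ₛ ξ) ∘ₛ ζ ≈s δ ∘ₛ (ξ ∘ₛ ζ)
    p∘,   : (δ : Sub Γ Δ) (t : Tm Γ τ) → p ∘ₛ (δ ,ₛ t) ≈s δ
    ,∘    : (ξ : Sub Δ Ξ) (t : Tm Δ τ) (δ : Sub Γ Δ) → (ξ ,ₛ t) ∘ₛ δ ≈s (ξ ∘ₛ δ) ,ₛ (t [ δ ])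
    p,v   : idₛ ≈s (p ,ₛ v {τ} {Γ})

  TmS : Ctx → Type → Setoid lzero lzero
  TmS Γ τ = record { Carrier = Tm Γ τ ; _≈_ = _≈t_
                   ; isEquivalence = record { refl = reflt ; sym = symt ; trans = transt } }

  SubS : Ctx → Ctx → Setoid lzero lzero
  SubS Γ Δ = record { Carrier = Sub Γ Δ ; _≈_ = _≈s_
                    ; isEquivalence = record { refl = refls ; sym = syms ; trans = transs } }

  data Var : Ctx → Type → Set where
    vz : Var (τ ∷ Γ) τ
    vs : Var Γ τ → Var (σ ∷ Γ) τ

  rest : Var Γ τ → Ctx
  rest (vz {Γ = Γ}) = Γ
  rest (vs x) = rest x

  pᵏ : (x : Var Γ τ) → Sub Γ (τ ∷ rest x)
  pᵏ vz     = idₛ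
  pᵏ (vs x) = pᵏ x ∘ₛ p

  ⌜_⌝ : Var Γ τ → Tm Γ τ
  ⌜ x ⌝ = v [ pᵏ x ]

  -- Ren Γ Δ : renamings Γ → Δ, assigning to each entry of Δ a variable of Γ
  -- of the same type (entries of Δ are given by positions  Var Δ τ).
  Ren : Ctx → Ctx → Set
  Ren Γ Δ = ∀ {τ} → Var Δ τ → Var Γ τ

  infix 4 _≗ᴿ_
  _≗ᴿ_ : Ren Γ Δ → Ren Γ Δ → Set
  ρ ≗ᴿ ρ' = ∀ {τ} (x : Var _ τ) → ρ x ≡ ρ' x

  idᴿ : Ren Γ Γ
  idᴿ x = x

  -- composition in Ren: for ρ : Γ → Δ and ρ' : Ξ → Γ,  ρ ∘ᴿ ρ' : Ξ → Δ
  infixr 9 _∘ᴿ_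
  _∘ᴿ_ : Ren Γ Δ → Ren Ξ Γ → Ren Ξ Δ
  (ρ ∘ᴿ ρ') x = ρ' (ρ x)

  wkᴿ : Ren (σ ∷ Γ) Γ
  wkᴿ = vs

  liftᴿ : Ren Γ Δ → Ren (σ ∷ Γ) (σ ∷ Δ)
  liftᴿ ρ vz     = vz
  liftᴿ ρ (vs x) = vs (ρ x)

  wk! : (Γ : Ctx) → Sub Γ []
  wk! []      = idₛ
  wk! (_ ∷ Γ) = wk! Γ ∘ₛ p

  iᴿ : {Δ : Ctx} → Ren Γ Δ → Sub Γ Δ
  iᴿ {Γ} {[]}    ρ = wk! Γ
  iᴿ {Γ} {_ ∷ Δ} ρ = iᴿ (λ x → ρ (vs x)) ,ₛ ⌜ ρ vz ⌝

  module _ where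
    iᴿ-resp : {ρ ρ' : Ren Γ Δ} → ρ ≗ᴿ ρ' → iᴿ ρ ≡ iᴿ ρ'
    iᴿ-resp {Δ = []}    e = refl
    iᴿ-resp {Δ = _ ∷ Δ} e = cong₂ _,ₛ_ (iᴿ-resp (λ x → e (vs x))) (cong ⌜_⌝ (e vz))

    wk!-nat : (ρ : Ren Γ Δ) → wk! Δ ∘ₛ iᴿ ρ ≈s wk! Γ
    wk!-nat {Δ = []}    ρ = idl _
    wk!-nat {Δ = _ ∷ Δ} ρ =
      transs (assoc _ _ _) (transs (∘-cong refls (p∘, _ _)) (wk!-nat (λ x → ρ (vs x))))

    lookup : (x : Var Δ τ) (ρ : Ren Γ Δ) → v [ pᵏ x ∘ₛ iᴿ ρ ] ≈t ⌜ ρ x ⌝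
    lookup vz     ρ = transt ([]-cong reflt (idl _)) (v[,] _ _)
    lookup (vs x) ρ = transt ([]-cong reflt (transs (assoc _ _ _) (∘-cong refls (p∘, _ _))))
                             (lookup x (λ y → ρ (vs y)))

    var[] : (x : Var Δ τ) (ρ : Ren Γ Δ) → ⌜ x ⌝ [ iᴿ ρ ] ≈t ⌜ ρ x ⌝
    var[] x ρ = transt ([][] _ _ _) (lookup x ρ)

    iᴿ-∘ : (ρ : Ren Γ Δ) (ρ' : Ren Ξ Γ) → iᴿ (ρ ∘ᴿ ρ') ≈s iᴿ ρ ∘ₛ iᴿ ρ'
    iᴿ-∘ {Δ = []}    ρ ρ' = syms (wk!-nat ρ')
    iᴿ-∘ {Δ = _ ∷ Δ} ρ ρ' =
      transs (,-cong (iᴿ-∘ (λ x → ρ (vs x)) ρ') (symt (var[] (ρ vz) ρ'))) (syms (,∘ _ _ _))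

    iᴿ-wk : (ρ : Ren Γ Δ) → iᴿ {σ ∷ Γ} (λ x → vs (ρ x)) ≈s iᴿ ρ ∘ₛ p
    iᴿ-wk {Δ = []}    ρ = refls
    iᴿ-wk {Δ = _ ∷ Δ} ρ =
      transs (,-cong (iᴿ-wk (λ x → ρ (vs x))) (symt ([][] _ _ _))) (syms (,∘ _ _ _))

    iᴿ-id : iᴿ (idᴿ {Γ}) ≈s idₛ
    iᴿ-id {[]}    = refls
    iᴿ-id {_ ∷ Γ} =
      transs (,-cong (transs (iᴿ-wk idᴿ) (transs (∘-cong iᴿ-id refls) (idl _))) v[id]) (syms p,v)

    iᴿ-wkᴿ : iᴿ (wkᴿ {σ} {Γ}) ≈s p
    iᴿ-wkᴿ = transs (iᴿ-wk idᴿ) (transs (∘-cong iᴿ-id refls) (idl _))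

    iᴿ-lift : (ρ : Ren Γ Δ) → iᴿ (liftᴿ {σ = σ} ρ) ≈s (iᴿ ρ ∘ₛ p) ,ₛ v
    iᴿ-lift ρ = ,-cong (iᴿ-wk ρ) v[id]

  data Ne (Γ : Ctx) : Type → Set
  data Nf (Γ : Ctx) : Type → Set
  data NfSub (Γ : Ctx) : Ctx → Set

  data Ne Γ where
    var : Var Γ τ → Ne Γ τ
    opn : (ϑ : Op) → NfSub Γ (dom ϑ) → Ne Γ (cod ϑ)
    app : Ne Γ (σ ⇒ τ) → Nf Γ σ → Ne Γ τ
    fst : Ne Γ (σ ⊗ τ) → Ne Γ σ
    snd : Ne Γ (σ ⊗ τ) → Ne Γ τ

  data Nf Γ where
    ne   : {a : Sort} → Ne Γ (base a) → Nf Γ (base a)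
    lam  : Nf (σ ∷ Γ) τ → Nf Γ (σ ⇒ τ)
    pair : Nf Γ σ → Nf Γ τ → Nf Γ (σ ⊗ τ)

  data NfSub Γ where
    ε   : NfSub Γ []
    _▸_ : NfSub Γ Δ → Nf Γ τ → NfSub Γ (τ ∷ Δ)

  renNe : Ren Δ Γ → Ne Γ τ → Ne Δ τ
  renNf : Ren Δ Γ → Nf Γ τ → Nf Δ τ
  renNfs : Ren Δ Γ → NfSub Γ Ξ → NfSub Δ Ξ

  renNe ρ (var x)   = var (ρ x)
  renNe ρ (opn ϑ δ) = opn ϑ (renNfs ρ δ)
  renNe ρ (app t s) = app (renNe ρ t) (renNf ρ s)
  renNe ρ (fst t)   = fst (renNe ρ t)
  renNe ρ (snd t)   = snd (renNe ρ t)
  renNf ρ (ne t)     = ne (renNe ρ t)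
  renNf ρ (lam t)    = lam (renNf (liftᴿ ρ) t)
  renNf ρ (pair t s) = pair (renNf ρ t) (renNf ρ s)
  renNfs ρ ε       = ε
  renNfs ρ (δ ▸ t) = renNfs ρ δ ▸ renNf ρ t

  liftᴿ-resp : {ρ ρ' : Ren Δ Γ} → ρ ≗ᴿ ρ' → liftᴿ {σ = σ} ρ ≗ᴿ liftᴿ ρ'
  liftᴿ-resp e vz     = refl
  liftᴿ-resp e (vs x) = cong vs (e x)

  renNe-resp : {ρ ρ' : Ren Δ Γ} → ρ ≗ᴿ ρ' → (t : Ne Γ τ) → renNe ρ t ≡ renNe ρ' t
  renNf-resp : {ρ ρ' : Ren Δ Γ} → ρ ≗ᴿ ρ' → (t : Nf Γ τ) → renNf ρ t ≡ renNf ρ' t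
  renNfs-resp : {ρ ρ' : Ren Δ Γ} → ρ ≗ᴿ ρ' → (t : NfSub Γ Ξ) → renNfs ρ t ≡ renNfs ρ' t
  renNe-resp e (var x)   = cong var (e x)
  renNe-resp e (opn ϑ δ) = cong (opn ϑ) (renNfs-resp e δ)
  renNe-resp e (app t s) = cong₂ app (renNe-resp e t) (renNf-resp e s)
  renNe-resp e (fst t)   = cong fst (renNe-resp e t)
  renNe-resp e (snd t)   = cong snd (renNe-resp e t)
  renNf-resp e (ne t)     = cong ne (renNe-resp e t)
  renNf-resp e (lam t)    = cong lam (renNf-resp (liftᴿ-resp e) t)
  renNf-resp e (pair t s) = cong₂ pair (renNf-resp e t) (renNf-resp e s)
  renNfs-resp e ε       = refl
  renNfs-resp e (δ ▸ t) = cong₂ _▸_ (renNfs-resp e δ) (renNf-resp e t)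

  liftᴿ-id : liftᴿ {σ = σ} (idᴿ {Γ}) ≗ᴿ idᴿ
  liftᴿ-id vz     = refl
  liftᴿ-id (vs x) = refl

  renNe-id : (t : Ne Γ τ) → renNe idᴿ t ≡ t
  renNf-id : (t : Nf Γ τ) → renNf idᴿ t ≡ t
  renNfs-id : (t : NfSub Γ Ξ) → renNfs idᴿ t ≡ t
  renNe-id (var x)   = refl
  renNe-id (opn ϑ δ) = cong (opn ϑ) (renNfs-id δ)
  renNe-id (app t s) = cong₂ app (renNe-id t) (renNf-id s)
  renNe-id (fst t)   = cong fst (renNe-id t)
  renNe-id (snd t)   = cong snd (renNe-id t)
  renNf-id (ne t)     = cong ne (renNe-id t)
  renNf-id (lam t)    = cong lam (≡.trans (renNf-resp liftᴿ-id t) (renNf-id t))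
  renNf-id (pair t s) = cong₂ pair (renNf-id t) (renNf-id s)
  renNfs-id ε       = refl
  renNfs-id (δ ▸ t) = cong₂ _▸_ (renNfs-id δ) (renNf-id t)

  liftᴿ-∘ : (ρ : Ren Δ Γ) (ρ' : Ren Ξ Δ) → liftᴿ {σ = σ} (ρ ∘ᴿ ρ') ≗ᴿ liftᴿ ρ ∘ᴿ liftᴿ ρ'
  liftᴿ-∘ ρ ρ' vz     = refl
  liftᴿ-∘ ρ ρ' (vs x) = refl

  renNe-∘ : (ρ : Ren Δ Γ) (ρ' : Ren Ξ Δ) (t : Ne Γ τ) → renNe (ρ ∘ᴿ ρ') t ≡ renNe ρ' (renNe ρ t)
  renNf-∘ : (ρ : Ren Δ Γ) (ρ' : Ren Ξ Δ) (t : Nf Γ τ) → renNf (ρ ∘ᴿ ρ') t ≡ renNf ρ' (renNf ρ t)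
  renNfs-∘ : (ρ : Ren Δ Γ) (ρ' : Ren Ξ Δ) (t : NfSub Γ Θ) → renNfs (ρ ∘ᴿ ρ') t ≡ renNfs ρ' (renNfs ρ t)
  renNe-∘ ρ ρ' (var x)   = refl
  renNe-∘ ρ ρ' (opn ϑ δ) = cong (opn ϑ) (renNfs-∘ ρ ρ' δ)
  renNe-∘ ρ ρ' (app t s) = cong₂ app (renNe-∘ ρ ρ' t) (renNf-∘ ρ ρ' s)
  renNe-∘ ρ ρ' (fst t)   = cong fst (renNe-∘ ρ ρ' t)
  renNe-∘ ρ ρ' (snd t)   = cong snd (renNe-∘ ρ ρ' t)
  renNf-∘ ρ ρ' (ne t)     = cong ne (renNe-∘ ρ ρ' t)
  renNf-∘ ρ ρ' (lam t)    = cong lam (≡.trans (renNf-resp (liftᴿ-∘ ρ ρ') t) (renNf-∘ (liftᴿ ρ) (liftᴿ ρ') t))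
  renNf-∘ ρ ρ' (pair t s) = cong₂ pair (renNf-∘ ρ ρ' t) (renNf-∘ ρ ρ' s)
  renNfs-∘ ρ ρ' ε       = refl
  renNfs-∘ ρ ρ' (δ ▸ t) = cong₂ _▸_ (renNfs-∘ ρ ρ' δ) (renNf-∘ ρ ρ' t)

  ⌊_⌋ne : Ne Γ τ → Tm Γ τ
  ⌊_⌋nf : Nf Γ τ → Tm Γ τ
  ⌊_⌋nfs : NfSub Γ Δ → Sub Γ Δ
  ⌊ var x ⌋ne   = ⌜ x ⌝
  ⌊ opn ϑ δ ⌋ne = op ϑ [ ⌊ δ ⌋nfs ]
  ⌊ app t s ⌋ne = app ⌊ t ⌋ne ⌊ s ⌋nf
  ⌊ fst t ⌋ne   = fst ⌊ t ⌋ne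
  ⌊ snd t ⌋ne   = snd ⌊ t ⌋ne
  ⌊ ne t ⌋nf     = ⌊ t ⌋ne
  ⌊ lam t ⌋nf    = lam ⌊ t ⌋nf
  ⌊ pair t s ⌋nf = pair ⌊ t ⌋nf ⌊ s ⌋nf
  ⌊_⌋nfs {Γ} ε   = wk! Γ
  ⌊ δ ▸ t ⌋nfs   = ⌊ δ ⌋nfs ,ₛ ⌊ t ⌋nf

  ⌊⌋ne-nat : (ρ : Ren Δ Γ) (t : Ne Γ τ) → ⌊ renNe ρ t ⌋ne ≈t ⌊ t ⌋ne [ iᴿ ρ ]
  ⌊⌋nf-nat : (ρ : Ren Δ Γ) (t : Nf Γ τ) → ⌊ renNf ρ t ⌋nf ≈t ⌊ t ⌋nf [ iᴿ ρ ]
  ⌊⌋nfs-nat : (ρ : Ren Δ Γ) (t : NfSub Γ Ξ) → ⌊ renNfs ρ t ⌋nfs ≈s ⌊ t ⌋nfs ∘ₛ iᴿ ρ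
  ⌊⌋ne-nat ρ (var x)   = symt (var[] x ρ)
  ⌊⌋ne-nat ρ (opn ϑ δ) = transt ([]-cong reflt (⌊⌋nfs-nat ρ δ)) (symt ([][] _ _ _))
  ⌊⌋ne-nat ρ (app t s) = transt (app-cong (⌊⌋ne-nat ρ t) (⌊⌋nf-nat ρ s)) (symt (app[] _ _ _))
  ⌊⌋ne-nat ρ (fst t)   = transt (fst-cong (⌊⌋ne-nat ρ t)) (symt (fst[] _ _))
  ⌊⌋ne-nat ρ (snd t)   = transt (snd-cong (⌊⌋ne-nat ρ t)) (symt (snd[] _ _))
  ⌊⌋nf-nat ρ (ne t)     = ⌊⌋ne-nat ρ t
  ⌊⌋nf-nat ρ (lam t)    =
    transt (lam-cong (transt (⌊⌋nf-nat (liftᴿ ρ) t) ([]-cong reflt (iᴿ-lift ρ)))) (symt (lam[] _ _))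
  ⌊⌋nf-nat ρ (pair t s) = transt (pair-cong (⌊⌋nf-nat ρ t) (⌊⌋nf-nat ρ s)) (symt (pair[] _ _ _))
  ⌊⌋nfs-nat ρ ε       = syms (wk!-nat ρ)
  ⌊⌋nfs-nat ρ (δ ▸ t) = transs (,-cong (⌊⌋nfs-nat ρ δ) (⌊⌋nf-nat ρ t)) (syms (,∘ _ _ _))

  -- Presheaves (of sets, presented as setoids) on Ren(Σ)

  record Psh : Set₁ where
    infix 4 _≈_
    field
      Ob       : Ctx → Set
      _≈_      : ∀ {Γ} → Ob Γ → Ob Γ → Set
      ≈-equiv  : ∀ {Γ} → IsEquivalence (_≈_ {Γ})
      map      : ∀ {Γ Δ} → Ren Δ Γ → Ob Γ → Ob Δ
      map-resp : ∀ {Γ Δ} {ρ ρ' : Ren Δ Γ} {x y : Ob Γ} → ρ ≗ᴿ ρ' → x ≈ y → map ρ x ≈ map ρ' y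
      map-id   : ∀ {Γ} (x : Ob Γ) → map idᴿ x ≈ x
      map-∘    : ∀ {Γ Δ Ξ} (ρ : Ren Δ Γ) (ρ' : Ren Ξ Δ) (x : Ob Γ) →
                 map (ρ ∘ᴿ ρ') x ≈ map ρ' (map ρ x)
    module E {Γ} = IsEquivalence (≈-equiv {Γ})

  infix 4 _⇒ᴾ_
  record _⇒ᴾ_ (A B : Psh) : Set where
    private
      module A = Psh A
      module B = Psh B
    field
      η       : ∀ {Γ} → A.Ob Γ → B.Ob Γ
      resp    : ∀ {Γ} {x y : A.Ob Γ} → x A.≈ y → η x B.≈ η y
      natural : ∀ {Γ Δ} (ρ : Ren Δ Γ) (x : A.Ob Γ) → η (A.map ρ x) B.≈ B.map ρ (η x)

  idᴾ : {A : Psh} → A ⇒ᴾ A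
  idᴾ {A} = record { η = λ x → x ; resp = λ e → e ; natural = λ ρ x → Psh.E.refl A }

  infixr 9 _∘ᴾ_
  _∘ᴾ_ : {A B C : Psh} → B ⇒ᴾ C → A ⇒ᴾ B → A ⇒ᴾ C
  _∘ᴾ_ {A} {B} {C} g f = record
    { η = λ x → g.η (f.η x)
    ; resp = λ e → g.resp (f.resp e)
    ; natural = λ ρ x → Psh.E.trans C (g.resp (f.natural ρ x)) (g.natural ρ (f.η x)) }
    where module f = _⇒ᴾ_ f
          module g = _⇒ᴾ_ g

  discrete : (F : Ctx → Set) (ren : ∀ {Γ Δ} → Ren Δ Γ → F Γ → F Δ)
             (ren-resp : ∀ {Γ Δ} {ρ ρ' : Ren Δ Γ} → ρ ≗ᴿ ρ' → (x : F Γ) → ren ρ x ≡ ren ρ' x)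
             (ren-id : ∀ {Γ} (x : F Γ) → ren idᴿ x ≡ x)
             (ren-∘ : ∀ {Γ Δ Ξ} (ρ : Ren Δ Γ) (ρ' : Ren Ξ Δ) (x : F Γ) → ren (ρ ∘ᴿ ρ') x ≡ ren ρ' (ren ρ x))
             → Psh
  discrete F ren ren-resp ren-id ren-∘ = record
    { Ob = F ; _≈_ = _≡_ ; ≈-equiv = ≡.isEquivalence ; map = ren
    ; map-resp = λ { e refl → ren-resp e _ } ; map-id = ren-id ; map-∘ = ren-∘ }

  NE : Type → Psh
  NE τ = discrete (λ Γ → Ne Γ τ) renNe renNe-resp renNe-id renNe-∘

  NF : Type → Psh
  NF τ = discrete (λ Γ → Nf Γ τ) renNf renNf-resp renNf-id renNf-∘

  -- TM(Δ) = Hom_Cl(i(-), Δ)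
  TM : Ctx → Psh
  TM Δ = record
    { Ob = λ Γ → Sub Γ Δ ; _≈_ = _≈s_
    ; ≈-equiv = record { refl = refls ; sym = syms ; trans = transs }
    ; map = λ ρ δ → δ ∘ₛ iᴿ ρ
    ; map-resp = λ e d → ∘-cong d (≡→≈ (iᴿ-resp e))
    ; map-id = λ δ → transs (∘-cong refls iᴿ-id) (idr δ)
    ; map-∘ = λ ρ ρ' δ → transs (∘-cong refls (iᴿ-∘ ρ ρ')) (syms (assoc _ _ _)) }
    where ≡→≈ : ∀ {Γ Δ} {δ δ' : Sub Γ Δ} → δ ≡ δ' → δ ≈s δ'
          ≡→≈ refl = refls

  TMₘ : Sub Γ Δ → TM Γ ⇒ᴾ TM Δ
  TMₘ δ = record { η = λ ξ → δ ∘ₛ ξ ; resp = ∘-cong refls ; natural = λ ρ ξ → syms (assoc _ _ _) }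

  -- a term Γ ⊢ t : τ as a morphism Γ → [τ] of Cl(Σ)
  ⟨_⟩ₜ : Tm Γ τ → Sub Γ (τ ∷ [])
  ⟨_⟩ₜ {Γ} t = wk! Γ ,ₛ t

  ⟨⟩ₜ-nat : (ρ : Ren Δ Γ) (t : Tm Γ τ) → ⟨ t [ iᴿ ρ ] ⟩ₜ ≈s ⟨ t ⟩ₜ ∘ₛ iᴿ ρ
  ⟨⟩ₜ-nat ρ t = syms (transs (,∘ _ _ _) (,-cong (wk!-nat ρ) reflt))

  appₘ : Sub Γ ((σ ⇒ τ) ∷ []) → Sub Γ (σ ∷ []) → Sub Γ (τ ∷ [])
  appₘ t s = ⟨ app (v [ t ]) (v [ s ]) ⟩ₜ

  ↓ne : (τ : Type) → NE τ ⇒ᴾ TM (τ ∷ [])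
  ↓ne τ = record { η = λ n → ⟨ ⌊ n ⌋ne ⟩ₜ ; resp = λ { refl → refls }
                 ; natural = λ ρ n → transs (,-cong refls (⌊⌋ne-nat ρ n)) (⟨⟩ₜ-nat ρ _) }

  ↓nf : (τ : Type) → NF τ ⇒ᴾ TM (τ ∷ [])
  ↓nf τ = record { η = λ n → ⟨ ⌊ n ⌋nf ⟩ₜ ; resp = λ { refl → refls }
                 ; natural = λ ρ n → transs (,-cong refls (⌊⌋nf-nat ρ n)) (⟨⟩ₜ-nat ρ _) }

  -- Exponentials B^A of presheaves: B^A(Γ) = Nat(y(Γ) × A , B)

  record Exp (A B : Psh) (Γ : Ctx) : Set where
    private
      module A = Psh A
      module B = Psh B
    field
      fun      : ∀ {Δ} → Ren Δ Γ → A.Ob Δ → B.Ob Δ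
      fun-resp : ∀ {Δ} {ρ ρ' : Ren Δ Γ} {x y : A.Ob Δ} → ρ ≗ᴿ ρ' → x A.≈ y → fun ρ x B.≈ fun ρ' y
      natural  : ∀ {Δ Ξ} (ρ : Ren Δ Γ) (ρ' : Ren Ξ Δ) (x : A.Ob Δ) →
                 fun (ρ ∘ᴿ ρ') (A.map ρ' x) B.≈ B.map ρ' (fun ρ x)

  -- The logical predicates P_τ with reflect_τ and reify_τ
  -- (bundled with the fact  ↓nf ∘ reify ∘ reflect = ↓ne  that the
  -- definition of reflect at function types relies on)

  record Model (τ : Type) : Set₁ where
    field
      P       : Psh
      reflect : NE τ ⇒ᴾ P
      reify   : P ⇒ᴾ NF τ
      reify-reflect : ∀ {Γ} (n : Ne Γ τ) → ⌊ _⇒ᴾ_.η reify (_⇒ᴾ_.η reflect n) ⌋nf ≈t ⌊ n ⌋ne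

  baseModel : (a : Sort) → Model (base a)
  baseModel a = record
    { P = NF (base a)
    ; reflect = record { η = ne ; resp = λ { refl → refl } ; natural = λ ρ n → refl }
    ; reify = idᴾ
    ; reify-reflect = λ n → reflt }

  prodPsh : Psh → Psh → Psh
  prodPsh A B = record
    { Ob = λ Γ → A.Ob Γ × B.Ob Γ
    ; _≈_ = λ x y → (proj₁ x A.≈ proj₁ y) × (proj₂ x B.≈ proj₂ y)
    ; ≈-equiv = record { refl = A.E.refl , B.E.refl
                       ; sym = λ (e , f) → A.E.sym e , B.E.sym f
                       ; trans = λ (e , f) (e' , f') → A.E.trans e e' , B.E.trans f f' }
    ; map = λ ρ (a , b) → A.map ρ a , B.map ρ b
    ; map-resp = λ r (e , f) → A.map-resp r e , B.map-resp r f
    ; map-id = λ (a , b) → A.map-id a , B.map-id b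
    ; map-∘ = λ ρ ρ' (a , b) → A.map-∘ ρ ρ' a , B.map-∘ ρ ρ' b }
    where module A = Psh A
          module B = Psh B

  prodModel : Model σ → Model τ → Model (σ ⊗ τ)
  prodModel {σ} {τ} Mσ Mτ = record
    { P = prodPsh S.P T.P
    ; reflect = record
        { η = λ n → Sreflect.η (fst n) , Treflect.η (snd n)
        ; resp = λ { refl → Psh.E.refl S.P , Psh.E.refl T.P }
        ; natural = λ ρ n → Sreflect.natural ρ (fst n) , Treflect.natural ρ (snd n) }
    ; reify = record
        { η = λ (a , b) → pair (Sreify.η a) (Treify.η b)
        ; resp = λ (e , f) → cong₂ pair (Sreify.resp e) (Treify.resp f)
        ; natural = λ ρ (a , b) → cong₂ pair (Sreify.natural ρ a) (Treify.natural ρ b) }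
    ; reify-reflect = λ n →
        transt (pair-cong (S.reify-reflect (fst n)) (T.reify-reflect (snd n))) (symt (⊗η _)) }
    where module S = Model Mσ
          module T = Model Mτ
          module Sreflect = _⇒ᴾ_ S.reflect
          module Sreify = _⇒ᴾ_ S.reify
          module Treflect = _⇒ᴾ_ T.reflect
          module Treify = _⇒ᴾ_ T.reify

  -- function types: P_{σ→τ} is the pullback of φ along ψ
  module Arrow {σ τ : Type} (Mσ : Model σ) (Mτ : Model τ) where
    private
      module S = Model Mσ
      module T = Model Mτ
      module Sreflect = _⇒ᴾ_ S.reflect
      module Sreify = _⇒ᴾ_ S.reify
      module Treflect = _⇒ᴾ_ T.reflect
      module Treify = _⇒ᴾ_ T.reify
      module PS = Psh S.P
      module PT = Psh T.P

    -- elements (t , F) of the pullback at stage Γ: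
    --   t ∈ TM(σ → τ)(Γ),  F ∈ P_τ^{P_σ}(Γ),  ψ(t) = φ(F) in TM(τ)^{P_σ}(Γ)
    record El (Γ : Ctx) : Set where
      constructor el
      field
        tm : Sub Γ ((σ ⇒ τ) ∷ [])
        F  : Exp S.P T.P Γ
        pb : ∀ {Δ} (ρ : Ren Δ Γ) (x : PS.Ob Δ) →
             appₘ (tm ∘ₛ iᴿ ρ) (_⇒ᴾ_.η (↓nf σ) (Sreify.η x))
               ≈s _⇒ᴾ_.η (↓nf τ) (Treify.η (Exp.fun F ρ x))

    _≈El_ : ∀ {Γ} → El Γ → El Γ → Set
    e ≈El e' = (El.tm e ≈s El.tm e')
             × (∀ {Δ} (ρ : Ren Δ _) (x : PS.Ob Δ) → Exp.fun (El.F e) ρ x PT.≈ Exp.fun (El.F e') ρ x)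

    appₘ-cong : ∀ {Γ} {f f' : Sub Γ ((σ ⇒ τ) ∷ [])} {s s' : Sub Γ (σ ∷ [])} →
                f ≈s f' → s ≈s s' → appₘ f s ≈s appₘ f' s'
    appₘ-cong e f = ,-cong refls (app-cong ([]-cong reflt e) ([]-cong reflt f))

    mapEl : ∀ {Γ Δ} → Ren Δ Γ → El Γ → El Δ
    mapEl ρ (el t F pb) = el (t ∘ₛ iᴿ ρ)
      (record { fun = λ ρ' x → Exp.fun F (ρ ∘ᴿ ρ') x
              ; fun-resp = λ e xy → Exp.fun-resp F (λ y → e (ρ y)) xy
              ; natural = λ ρ' ρ'' x → Exp.natural F (ρ ∘ᴿ ρ') ρ'' x })
      (λ ρ' x → transs (appₘ-cong (transs (assoc _ _ _) (∘-cong refls (syms (iᴿ-∘ ρ ρ')))) refls)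
                       (pb (ρ ∘ᴿ ρ') x))

    P : Psh
    P = record
      { Ob = El ; _≈_ = _≈El_
      ; ≈-equiv = record
          { refl = refls , λ ρ x → PT.E.refl
          ; sym = λ (e , f) → syms e , λ ρ x → PT.E.sym (f ρ x)
          ; trans = λ (e , f) (e' , f') → transs e e' , λ ρ x → PT.E.trans (f ρ x) (f' ρ x) }
      ; map = mapEl
      ; map-resp = λ {_} {_} {ρ} {ρ'} {x} r (e , f) →
          ∘-cong e (≡→≈ (iᴿ-resp r)) ,
          λ ρ'' a → PT.E.trans (Exp.fun-resp (El.F x) (λ y → cong ρ'' (r y)) PS.E.refl) (f (ρ' ∘ᴿ ρ'') a)
      ; map-id = λ x → transs (∘-cong refls iᴿ-id) (idr _) , λ ρ a → PT.E.refl
      ; map-∘ = λ ρ ρ' x → transs (∘-cong refls (iᴿ-∘ ρ ρ')) (syms (assoc _ _ _)) , λ ρ'' a → PT.E.refl }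
      where ≡→≈ : ∀ {Γ Δ} {δ δ' : Sub Γ Δ} → δ ≡ δ' → δ ≈s δ'
            ≡→≈ refl = refls

    reflectη : ∀ {Γ} → Ne Γ (σ ⇒ τ) → El Γ
    reflectη n = el (_⇒ᴾ_.η (↓ne (σ ⇒ τ)) n)
      (record { fun = λ ρ x → Treflect.η (app (renNe ρ n) (Sreify.η x))
              ; fun-resp = λ e xy → Treflect.resp (cong₂ app (renNe-resp e n) (Sreify.resp xy))
              ; natural = λ ρ ρ' x →
                  PT.E.trans (Treflect.resp (cong₂ app (renNe-∘ ρ ρ' n) (Sreify.natural ρ' x)))
                             (Treflect.natural ρ' (app (renNe ρ n) (Sreify.η x))) })
      (λ ρ x → ,-cong refls
         (transt (app-cong (transt ([]-cong reflt (,∘ _ _ _)) (transt (v[,] _ _) (symt (⌊⌋ne-nat ρ n))))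
                           (v[,] _ _))
                 (symt (T.reify-reflect (app (renNe ρ n) (Sreify.η x))))))

    reflect : NE (σ ⇒ τ) ⇒ᴾ P
    reflect = record
      { η = reflectη
      ; resp = λ { refl → refls , λ ρ x → PT.E.refl }
      ; natural = λ ρ n →
          transs (,-cong refls (⌊⌋ne-nat ρ n)) (⟨⟩ₜ-nat ρ _) ,
          λ ρ' x → Treflect.resp (cong₂ app (≡.sym (renNe-∘ ρ ρ' n)) refl) }

    reifyη : ∀ {Γ} → El Γ → Nf Γ (σ ⇒ τ)
    reifyη e = lam (Treify.η (Exp.fun (El.F e) wkᴿ (Sreflect.η (var vz))))

    reify : P ⇒ᴾ NF (σ ⇒ τ)
    reify = record
      { η = reifyη
      ; resp = λ (e , f) → cong lam (Treify.resp (f wkᴿ _))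
      ; natural = λ ρ e → cong lam (reify-nat ρ e) }
      where
        reify-nat : ∀ {Γ Δ} (ρ : Ren Δ Γ) (e : El Γ) →
          Treify.η (Exp.fun (El.F e) (ρ ∘ᴿ wkᴿ {σ}) (Sreflect.η (var vz)))
            ≡ renNf (liftᴿ ρ) (Treify.η (Exp.fun (El.F e) wkᴿ (Sreflect.η (var vz))))
        reify-nat {Γ} {Δ} ρ e =
          ≡.trans (Treify.resp (Exp.fun-resp (El.F e) {ρ = ρ ∘ᴿ wkᴿ} {ρ' = wkᴿ ∘ᴿ liftᴿ ρ} (λ y → refl) r1))
          (≡.trans (Treify.resp (Exp.natural (El.F e) wkᴿ (liftᴿ ρ) (Sreflect.η (var vz))))
                   (Treify.natural (liftᴿ ρ) _))
          where
            r1 : Sreflect.η {σ ∷ Δ} (var vz) PS.≈ PS.map (liftᴿ ρ) (Sreflect.η (var vz))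
            r1 = Sreflect.natural (liftᴿ ρ) (var vz)

    model : Model (σ ⇒ τ)
    model = record
      { P = P ; reflect = reflect ; reify = reify
      ; reify-reflect = λ n →
          transt (lam-cong (transt (T.reify-reflect _)
                   (app-cong (transt (⌊⌋ne-nat wkᴿ n) ([]-cong reflt iᴿ-wkᴿ))
                             (transt (S.reify-reflect (var vz)) v[id]))))
                 (symt (⇒η _)) }

  model : (τ : Type) → Model τ
  model (base a) = baseModel a
  model (σ ⊗ τ)  = prodModel (model σ) (model τ)
  model (σ ⇒ τ)  = Arrow.model (model σ) (model τ)

  P_ : Type → Psh
  P_ τ = Model.P (model τ)

  reify_ : (τ : Type) → P_ τ ⇒ᴾ NF τ
  reify_ τ = Model.reify (model τ)

  reflect_ : (τ : Type) → NE τ ⇒ᴾ P_ τ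
  reflect_ τ = Model.reflect (model τ)

  -- The gluing category  Gl(Σ) = id_{Psh(Ren Σ)} ↓ TM

  record GlObj : Set₁ where
    constructor glObj
    field
      D   : Psh
      ctx : Ctx
      q   : D ⇒ᴾ TM ctx

  record GlHom (X Y : GlObj) : Set where
    constructor glHom
    private
      module X = GlObj X
      module Y = GlObj Y
    field
      d    : X.D ⇒ᴾ Y.D
      δ    : Sub X.ctx Y.ctx
      comm : ∀ {Γ} (x : Psh.Ob X.D Γ) →
             _⇒ᴾ_.η Y.q (_⇒ᴾ_.η d x) ≈s _⇒ᴾ_.η (TMₘ δ) (_⇒ᴾ_.η X.q x)

  _≈Gl_ : ∀ {X Y} → GlHom X Y → GlHom X Y → Set
  _≈Gl_ {X} {Y} f g =
    (∀ {Γ} (x : Psh.Ob (GlObj.D X) Γ) →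
       Psh._≈_ (GlObj.D Y) (_⇒ᴾ_.η (GlHom.d f) x) (_⇒ᴾ_.η (GlHom.d g) x))
    × (GlHom.δ f ≈s GlHom.δ g)

  Gl : Category (lsuc lzero) lzero lzero
  Gl = record
    { Obj = GlObj
    ; Hom = GlHom
    ; _≈_ = _≈Gl_
    ; ≈-equiv = λ {A} {B} → record
        { refl = (λ x → Psh.E.refl (GlObj.D B)) , refls
        ; sym = λ (e , f) → (λ x → Psh.E.sym (GlObj.D B) (e x)) , syms f
        ; trans = λ (e , f) (e' , f') → (λ x → Psh.E.trans (GlObj.D B) (e x) (e' x)) , transs f f' }
    ; id = glHom idᴾ idₛ (λ x → syms (idl _))
    ; _∘_ = λ {A} {B} {C} g f →
        glHom (GlHom.d g ∘ᴾ GlHom.d f) (GlHom.δ g ∘ₛ GlHom.δ f)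
          (λ x → transs (GlHom.comm g _)
                 (transs (∘-cong refls (GlHom.comm f x)) (syms (assoc _ _ _))))
    ; identityˡ = λ {A} {B} → (λ x → Psh.E.refl (GlObj.D B)) , idl _
    ; identityʳ = λ {A} {B} → (λ x → Psh.E.refl (GlObj.D B)) , idr _
    ; assoc = λ {A} {B} {C} {D} → (λ x → Psh.E.refl (GlObj.D D)) , assoc _ _ _
    ; ∘-resp-≈ = λ {A} {B} {C} {f} {f'} (e , e₂) (g , g₂) →
        (λ x → Psh.E.trans (GlObj.D C) (e _) (_⇒ᴾ_.resp (GlHom.d f') (g x))) , ∘-cong e₂ g₂ }

  ⟦_⟧ : Type → GlObj
  ⟦ τ ⟧ = glObj (P_ τ) (τ ∷ []) (↓nf τ ∘ᴾ reify_ τ)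

module Submission where

open import Defs
open import Data.List using ([]; _∷_)
open import Data.Product using (_,_; proj₁; proj₂)
import Relation.Binary.Reasoning.Setoid as SetoidReasoning

-- The βη-laws for pairs make the context σ × τ a product of σ and τ in Cl(Σ), with
-- projections ⟨fst v⟩, ⟨snd v⟩ and pairing ⟨pair (v[f]) (v[g])⟩. Since P_{σ×τ} = P_σ × P_τ
-- and the read-back of a pair is the pairing of the read-backs, a glued morphism into
-- ⟦σ × τ⟧ is exactly a pair of glued morphisms, built componentwise.

module _ (𝔖 : Signature) where
  open Gluing 𝔖

  private
    variable
      σ τ : Type
      Γ Δ : Ctx

  wk!-terminal : (δ : Sub Γ Δ) → wk! Δ ∘ₛ δ ≈s wk! Γ
  wk!-terminal idₛ       = idr _
  wk!-terminal p         = refls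
  wk!-terminal (δ ,ₛ t)  =
    transs (assoc _ _ _) (transs (∘-cong refls (p∘, δ t)) (wk!-terminal δ))
  wk!-terminal (δ ∘ₛ ξ)  =
    transs (syms (assoc _ _ _)) (transs (∘-cong (wk!-terminal δ) refls) (wk!-terminal ξ))

  ⟨⟩ₜ-cong : {t t' : Tm Γ τ} → t ≈t t' → ⟨ t ⟩ₜ ≈s ⟨ t' ⟩ₜ
  ⟨⟩ₜ-cong = ,-cong refls

  ⟨⟩ₜ-∘ : (t : Tm Δ τ) (δ : Sub Γ Δ) → ⟨ t ⟩ₜ ∘ₛ δ ≈s ⟨ t [ δ ] ⟩ₜ
  ⟨⟩ₜ-∘ t δ = transs (,∘ _ _ _) (,-cong (wk!-terminal δ) reflt)

  ⟨v[]⟩ₜ : (δ : Sub Γ (τ ∷ [])) → ⟨ v [ δ ] ⟩ₜ ≈s δ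
  ⟨v[]⟩ₜ {Γ} δ = begin
    wk! Γ ,ₛ v [ δ ]           ≈⟨ ,-cong (syms (wk!-terminal δ)) reflt ⟩
    (idₛ ∘ₛ p) ∘ₛ δ ,ₛ v [ δ ]  ≈⟨ ,-cong (∘-cong (idl p) refls) reflt ⟩
    p ∘ₛ δ ,ₛ v [ δ ]           ≈⟨ syms (,∘ p v δ) ⟩
    (p ,ₛ v) ∘ₛ δ               ≈⟨ ∘-cong (syms p,v) refls ⟩
    idₛ ∘ₛ δ                    ≈⟨ idl δ ⟩
    δ                           ∎
    where open SetoidReasoning (SubS _ _)

  fstₘ : Sub ((σ ⊗ τ) ∷ []) (σ ∷ [])
  fstₘ = ⟨ fst v ⟩ₜ

  sndₘ : Sub ((σ ⊗ τ) ∷ []) (τ ∷ [])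
  sndₘ = ⟨ snd v ⟩ₜ

  pairₘ : Sub Γ (σ ∷ []) → Sub Γ (τ ∷ []) → Sub Γ ((σ ⊗ τ) ∷ [])
  pairₘ f g = ⟨ pair (v [ f ]) (v [ g ]) ⟩ₜ

  pairₘ-cong : {f f' : Sub Γ (σ ∷ [])} {g g' : Sub Γ (τ ∷ [])} →
               f ≈s f' → g ≈s g' → pairₘ f g ≈s pairₘ f' g'
  pairₘ-cong e e' = ⟨⟩ₜ-cong (pair-cong ([]-cong reflt e) ([]-cong reflt e'))

  pairₘ-∘ : (f : Sub Δ (σ ∷ [])) (g : Sub Δ (τ ∷ [])) (δ : Sub Γ Δ) →
            pairₘ f g ∘ₛ δ ≈s pairₘ (f ∘ₛ δ) (g ∘ₛ δ)
  pairₘ-∘ f g δ =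
    transs (⟨⟩ₜ-∘ _ δ) (⟨⟩ₜ-cong (transt (pair[] _ _ _) (pair-cong ([][] _ _ _) ([][] _ _ _))))

  ⟨pair⟩ₜ : (t : Tm Γ σ) (s : Tm Γ τ) → ⟨ pair t s ⟩ₜ ≈s pairₘ ⟨ t ⟩ₜ ⟨ s ⟩ₜ
  ⟨pair⟩ₜ t s = ⟨⟩ₜ-cong (pair-cong (symt (v[,] _ _)) (symt (v[,] _ _)))

  fstₘ-∘ : (δ : Sub Γ ((σ ⊗ τ) ∷ [])) → fstₘ ∘ₛ δ ≈s ⟨ fst (v [ δ ]) ⟩ₜ
  fstₘ-∘ δ = transs (⟨⟩ₜ-∘ _ δ) (⟨⟩ₜ-cong (fst[] _ _))

  sndₘ-∘ : (δ : Sub Γ ((σ ⊗ τ) ∷ [])) → sndₘ ∘ₛ δ ≈s ⟨ snd (v [ δ ]) ⟩ₜ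
  sndₘ-∘ δ = transs (⟨⟩ₜ-∘ _ δ) (⟨⟩ₜ-cong (snd[] _ _))

  fstₘ-pairₘ : (f : Sub Γ (σ ∷ [])) (g : Sub Γ (τ ∷ [])) → fstₘ ∘ₛ pairₘ f g ≈s f
  fstₘ-pairₘ f g =
    transs (fstₘ-∘ _) (transs (⟨⟩ₜ-cong (transt (fst-cong (v[,] _ _)) (⊗β₁ _ _))) (⟨v[]⟩ₜ f))

  sndₘ-pairₘ : (f : Sub Γ (σ ∷ [])) (g : Sub Γ (τ ∷ [])) → sndₘ ∘ₛ pairₘ f g ≈s g
  sndₘ-pairₘ f g =
    transs (sndₘ-∘ _) (transs (⟨⟩ₜ-cong (transt (snd-cong (v[,] _ _)) (⊗β₂ _ _))) (⟨v[]⟩ₜ g))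

  pairₘ-η : (h : Sub Γ ((σ ⊗ τ) ∷ [])) → pairₘ (fstₘ ∘ₛ h) (sndₘ ∘ₛ h) ≈s h
  pairₘ-η h = begin
    pairₘ (fstₘ ∘ₛ h) (sndₘ ∘ₛ h)                     ≈⟨ pairₘ-cong (fstₘ-∘ h) (sndₘ-∘ h) ⟩
    pairₘ ⟨ fst (v [ h ]) ⟩ₜ ⟨ snd (v [ h ]) ⟩ₜ        ≈⟨ syms (⟨pair⟩ₜ _ _) ⟩
    ⟨ pair (fst (v [ h ])) (snd (v [ h ])) ⟩ₜ          ≈⟨ ⟨⟩ₜ-cong (symt (⊗η _)) ⟩
    ⟨ v [ h ] ⟩ₜ                                       ≈⟨ ⟨v[]⟩ₜ h ⟩
    h                                                  ∎
    where open SetoidReasoning (SubS _ _)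

  proj₁ᴾ : {A B : Psh} → prodPsh A B ⇒ᴾ A
  proj₁ᴾ {A} = record { η = proj₁ ; resp = proj₁ ; natural = λ _ _ → Psh.E.refl A }

  proj₂ᴾ : {A B : Psh} → prodPsh A B ⇒ᴾ B
  proj₂ᴾ {B = B} = record { η = proj₂ ; resp = proj₂ ; natural = λ _ _ → Psh.E.refl B }

  ⟨_,_⟩ᴾ : {X A B : Psh} → X ⇒ᴾ A → X ⇒ᴾ B → X ⇒ᴾ prodPsh A B
  ⟨ f , g ⟩ᴾ = record
    { η       = λ x → F.η x , G.η x
    ; resp    = λ e → F.resp e , G.resp e
    ; natural = λ ρ x → F.natural ρ x , G.natural ρ x }
    where module F = _⇒ᴾ_ f
          module G = _⇒ᴾ_ g

  readback : (τ : Type) → Psh.Ob (P_ τ) Γ → Sub Γ (τ ∷ [])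
  readback τ = _⇒ᴾ_.η (GlObj.q ⟦ τ ⟧)

  readback-⊗ : (x : Psh.Ob (P_ (σ ⊗ τ)) Γ) →
               readback (σ ⊗ τ) x ≈s pairₘ (readback σ (proj₁ x)) (readback τ (proj₂ x))
  readback-⊗ _ = ⟨pair⟩ₜ _ _

  π₁ᴳ : GlHom ⟦ σ ⊗ τ ⟧ ⟦ σ ⟧
  π₁ᴳ = glHom proj₁ᴾ fstₘ
    (λ x → syms (transs (∘-cong refls (readback-⊗ x)) (fstₘ-pairₘ _ _)))

  π₂ᴳ : GlHom ⟦ σ ⊗ τ ⟧ ⟦ τ ⟧
  π₂ᴳ = glHom proj₂ᴾ sndₘ
    (λ x → syms (transs (∘-cong refls (readback-⊗ x)) (sndₘ-pairₘ _ _)))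

  ⟨_,_⟩ᴳ : {X : GlObj} → GlHom X ⟦ σ ⟧ → GlHom X ⟦ τ ⟧ → GlHom X ⟦ σ ⊗ τ ⟧
  ⟨_,_⟩ᴳ {σ} {τ} {X} (glHom d δ comm) (glHom d' δ' comm') =
    glHom ⟨ d , d' ⟩ᴾ (pairₘ δ δ') commutes
    where
      qX : Psh.Ob (GlObj.D X) Γ → Sub Γ (GlObj.ctx X)
      qX = _⇒ᴾ_.η (GlObj.q X)

      commutes : (x : Psh.Ob (GlObj.D X) Γ) →
                 readback (σ ⊗ τ) (_⇒ᴾ_.η ⟨ d , d' ⟩ᴾ x) ≈s pairₘ δ δ' ∘ₛ qX x
      commutes x = begin
        readback (σ ⊗ τ) (_⇒ᴾ_.η ⟨ d , d' ⟩ᴾ x)                    ≈⟨ readback-⊗ _ ⟩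
        pairₘ (readback σ (_⇒ᴾ_.η d x)) (readback τ (_⇒ᴾ_.η d' x)) ≈⟨ pairₘ-cong (comm x) (comm' x) ⟩
        pairₘ (δ ∘ₛ qX x) (δ' ∘ₛ qX x)                              ≈⟨ syms (pairₘ-∘ δ δ' _) ⟩
        pairₘ δ δ' ∘ₛ qX x                                          ∎
        where open SetoidReasoning (SubS _ _)

mainTheorem1 : (𝔖 : Signature) (σ τ : Ty (Signature.Sort 𝔖)) →
    IsProduct (Gluing.Gl 𝔖) (Gluing.⟦_⟧ 𝔖 σ) (Gluing.⟦_⟧ 𝔖 τ) (Gluing.⟦_⟧ 𝔖 (σ ⊗ τ))
mainTheorem1 𝔖 σ τ = record
  { π₁       = π₁ᴳ 𝔖
  ; π₂       = π₂ᴳ 𝔖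
  ; ⟨_,_⟩    = ⟨_,_⟩ᴳ 𝔖
  ; project₁ = (λ _ → Psh.E.refl (P_ σ)) , fstₘ-pairₘ 𝔖 _ _
  ; project₂ = (λ _ → Psh.E.refl (P_ τ)) , sndₘ-pairₘ 𝔖 _ _
  ; unique   = λ { {h = h} (e₁ , e₁') (e₂ , e₂') →
      (λ x → Psh.E.sym (P_ σ) (e₁ x) , Psh.E.sym (P_ τ) (e₂ x)) ,
      transs (pairₘ-cong 𝔖 (syms e₁') (syms e₂')) (pairₘ-η 𝔖 (GlHom.δ h)) }
  }
  where open Gluing 𝔖
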